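{- Let $a_0,d_0$ be coprime integers with $1 \le a_0 < d_0$, let $\langle A(a_0,d_0), A(a_1,d_1), \ldots \rangle$ be the sequence of arithmetic progressions $\mathfrak{S}(a_0,d_0)$, and let $\langle A(a_0,d_0), A(a_1,d_1), \ldots, A(a_\beta,d_\beta)\rangle$ (with $\beta \ge 1$) be its first grouping, with second common difference $\triangle$. Then $a_i = a_{\beta-i}$ for all $0 \le i \le \beta$ if and only if $\triangle$ divides $d_0^2 - 1$.
   Context: $A(x,y)$ denotes the arithmetic progression with leading term $x$ and common difference $y$. For coprime positive integers $a_0,d_0$, the sequence $\mathfrak{S}(a_0,d_0)$ is the finite sequence of distinct progressions $A(a_0,d_0), A(a_1,d_1), \ldots$ in which each consecutive pair satisfies $(a_k+jd_k)(a_{k+1}+jd_{k+1}) \equiv 1 \pmod{a_k+(j+1)d_k}$ for all $j\ge 0$, and $d_k \ge d_{k+1} \ge 1$. Explicitly: if $d_k = 1$ the sequence stops at $A(a_k,d_k)$; otherwise $d_{k+1}$ is the unique integer with $1 \le d_{k+1} < d_k$ and $a_k d_{k+1} \equiv 1 \pmod{d_k}$, and $a_{k+1} = d_{k+1} + \frac{a_k d_{k+1} - 1}{d_k}$. A grouping is a run $A(a_\alpha,d_\alpha),\ldots,A(a_\beta,d_\beta)$ of at least two consecutive progressions of the sequence such that $d_r - d_{r+1}$ equals a common value $\triangle$ (the second common difference) for all $\alpha \le r \le \beta-1$, and which is maximal with this property. The first grouping is the grouping with $\alpha = 0$, i.e. the maximal initial run $A(a_0,d_0),\ldots,A(a_\beta,d_\beta)$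 with $d_0-d_1 = d_1-d_2 = \cdots = d_{\beta-1}-d_\beta = \triangle$. The condition $a_i = a_{\beta-i}$ for all $0\le i\le\beta$ is what the paper calls symmetricity of the (leading terms of the) first grouping. -}

module Defs where

open import Data.Nat using (ℕ; zero; suc; _+_; _*_; _∸_; _≤_; _<_)
open import Data.Nat.Divisibility using (_∣_)
open import Data.Nat.Coprimality using (Coprime)
open import Data.Product using (Σ; _×_; ∃)
open import Data.Sum using (_⊎_)
open import Relation.Binary.PropositionalEquality using (_≡_; _≢_)
open import Function.Bundles using (_⇔_)

-- One step of 𝔖(a₀,d₀): from A(a,d) (with d > 1) to A(a',d') where
-- d' is the integer with 1 ≤ d' < d and a d' ≡ 1 (mod d), and
-- a' = d' + (a d' - 1)/d.
Step : ℕ → ℕ → ℕ → ℕ → Set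
Step a d a' d' =
  (1 ≤ d') × (d' < d) × ∃ λ q → (a * d' ≡ 1 + q * d) × (a' ≡ d' + q)

-- a, d : ℕ → ℕ are the leading terms / common differences of 𝔖(a₀,d₀),
-- and ⟨A(a 0,d 0), …, A(a β, d β)⟩ is its first grouping with second
-- common difference △:
--   * every progression up to index β is produced by the step rule,
--   * β ≥ 1 and d r - d (r+1) = △ for all r < β,
--   * maximality: either the sequence stops at β (d β = 1), or it
--     continues to A(a(β+1), d(β+1)) and d β - d (β+1) ≠ △.
FirstGrouping : (a d : ℕ → ℕ) (β △ : ℕ) → Set
FirstGrouping a d β △ =
  (∀ k → k < β → Step (a k) (d k) (a (suc k)) (d (suc k)))
  × (1 ≤ β)
  × (∀ r → r < β → d r ≡ d (suc r) + △)
  × ((d β ≡ 1)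
     ⊎ (Step (a β) (d β) (a (suc β)) (d (suc β)) × (d β ≢ d (suc β) + △)))

Symmetric : (a : ℕ → ℕ) (β : ℕ) → Set
Symmetric a β = ∀ i → i ≤ β → a i ≡ a (β ∸ i)

{-# OPTIONS --safe #-}
-- Along the first grouping d k = d 0 − k △.  Write a 0 △ + 1 = m d 0 (possible because
-- a 0 d 1 ≡ 1 and d 1 ≡ −△ modulo d 0); then every step of 𝔖 preserves a k △ + 1 = (m + k △) d k,
-- and the leading terms satisfy a k + k m = a 0 + k d k.  With r = d β this reads
-- a k = a 0 + k (r − m) + △ k (β − k), so the first grouping is symmetric iff m = r.
-- On the other hand m d 0 ≡ 1 and d 0 ≡ r modulo △, so △ ∣ d 0² − 1 iff m ≡ r (mod △), and
-- both lie in [1, △]: m because a 0 < d 0, and r by maximality, since d β ∣ a β △ + 1 forces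
-- d (β + 1) = d β − △ whenever △ < d β.
module Submission where

open import Defs
open import Data.List using ([]; _∷_)
open import Data.Nat using (ℕ; zero; suc; _+_; _*_; _∸_; _≤_; _<_; >-nonZero; z≤n; z<s)
open import Data.Nat.Coprimality using (Coprime)
open import Data.Nat.DivMod using (_%_; [m+kn]%n≡m%n; m<n⇒m%n≡m)
open import Data.Nat.Divisibility using (_∣_; divides; ∣m+n∣m⇒∣n; ∣n⇒∣m*n; n∣m*n)
open import Data.Nat.Properties
open import Data.Nat.Tactic.RingSolver using (solve)
open import Data.Product using (∃; _×_; _,_; proj₁; proj₂)
open import Data.Sum using (_⊎_; inj₁; inj₂)
open import Function.Bundles using (_⇔_; mk⇔)
open import Function.Properties.Equivalence using () renaming (trans to ⇔-trans)
open import Relation.Nullary using (contradiction)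
open import Relation.Binary.PropositionalEquality
  using (_≡_; _≢_; refl; sym; trans; cong; subst; subst₂; module ≡-Reasoning)

open ≡-Reasoning

residue-unique : ∀ {m r n} X Y → 0 < m → m ≤ n → 0 < r → r ≤ n →
                 m + X * n ≡ r + Y * n → m ≡ r
residue-unique {suc m} {suc r} {n} X Y _ m<n _ r<n eq = cong suc (begin
  m                ≡⟨ m<n⇒m%n≡m m<n ⟨
  m % n            ≡⟨ [m+kn]%n≡m%n m X n ⟨
  (m + X * n) % n  ≡⟨ cong (_% n) (suc-injective eq) ⟩
  (r + Y * n) % n  ≡⟨ [m+kn]%n≡m%n r Y n ⟩
  r % n            ≡⟨ m<n⇒m%n≡m r<n ⟩
  r                ∎)
  where instance _ = >-nonZero (m<n⇒0<n m<n)

m∣n∧0<n<m+m⇒n≡m : ∀ {m n} → m ∣ n → 0 < n → n < m + m → n ≡ m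
m∣n∧0<n<m+m⇒n≡m     (divides zero refl)          ()  _
m∣n∧0<n<m+m⇒n≡m {m} (divides (suc zero) refl)    _   _     = +-identityʳ m
m∣n∧0<n<m+m⇒n≡m {m} (divides (suc (suc k)) refl) _   n<2m  =
  contradiction n<2m (≤⇒≯ (+-monoʳ-≤ m (m≤m+n m (k * m))))

step-quotient : ∀ a d′ t q → a * d′ ≡ 1 + q * (d′ + t) →
                a * (d′ + t) ≡ (a * t + 1) + q * (d′ + t)
step-quotient a d′ t q eq = begin
  a * (d′ + t)                ≡⟨ solve (a ∷ d′ ∷ t ∷ []) ⟩
  a * t + a * d′              ≡⟨ cong (a * t +_) eq ⟩
  a * t + (1 + q * (d′ + t))  ≡⟨ +-assoc (a * t) 1 _ ⟨
  (a * t + 1) + q * (d′ + t)  ∎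

step-multiplier : ∀ {a a′ d′ t} → Step a (d′ + t) a′ d′ →
                  ∃ λ M → a * t + 1 ≡ M * (d′ + t)
step-multiplier {a} {d′ = d′} {t} (_ , _ , q , eq , _) = a ∸ q , sym (begin
  (a ∸ q) * (d′ + t)                          ≡⟨ *-distribʳ-∸ (d′ + t) a q ⟩
  a * (d′ + t) ∸ q * (d′ + t)                 ≡⟨ cong (_∸ q * (d′ + t)) (step-quotient a d′ t q eq) ⟩
  (a * t + 1) + q * (d′ + t) ∸ q * (d′ + t)   ≡⟨ m+n∸n≡m (a * t + 1) (q * (d′ + t)) ⟩
  a * t + 1                                   ∎)

step-successor : ∀ {a a′ d′ t M} → Step a (d′ + t) a′ d′ →
                 a * t + 1 ≡ M * (d′ + t) → a′ + M ≡ a + d′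
step-successor {a} {a′} {d′} {t} {M} (1≤d′ , _ , q , eq , a′≡d′+q) mult = begin
  a′ + M        ≡⟨ cong (_+ M) a′≡d′+q ⟩
  d′ + q + M    ≡⟨ solve (d′ ∷ q ∷ M ∷ []) ⟩
  d′ + (M + q)  ≡⟨ cong (d′ +_) M+q≡a ⟩
  d′ + a        ≡⟨ +-comm d′ a ⟩
  a + d′        ∎
  where
  instance _ = >-nonZero (≤-trans 1≤d′ (m≤m+n d′ t))
  M+q≡a : M + q ≡ a
  M+q≡a = *-cancelʳ-≡ (M + q) a (d′ + t) (begin
    (M + q) * (d′ + t)           ≡⟨ *-distribʳ-+ (d′ + t) M q ⟩
    M * (d′ + t) + q * (d′ + t)  ≡⟨ cong (_+ q * (d′ + t)) mult ⟨
    (a * t + 1) + q * (d′ + t)   ≡⟨ step-quotient a d′ t q eq ⟨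
    a * (d′ + t)                 ∎)

next-multiplier : ∀ {a a′ d′ t M} → a * t + 1 ≡ M * (d′ + t) → a′ + M ≡ a + d′ →
                  a′ * t + 1 ≡ (M + t) * d′
next-multiplier {a} {a′} {d′} {t} {M} mult succ = +-cancelʳ-≡ (M * t) _ _ (begin
  a′ * t + 1 + M * t     ≡⟨ solve (a′ ∷ t ∷ M ∷ []) ⟩
  (a′ + M) * t + 1       ≡⟨ cong (λ x → x * t + 1) succ ⟩
  (a + d′) * t + 1       ≡⟨ solve (a ∷ d′ ∷ t ∷ []) ⟩
  (a * t + 1) + d′ * t   ≡⟨ cong (_+ d′ * t) mult ⟩
  M * (d′ + t) + d′ * t  ≡⟨ solve (M ∷ d′ ∷ t ∷ []) ⟩
  (M + t) * d′ + M * t   ∎)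

closed-form-step : ∀ {a a′ a₀ m k d′ t} → a′ + (m + k * t) ≡ a + d′ →
                   a + k * m ≡ a₀ + k * (d′ + t) → a′ + suc k * m ≡ a₀ + suc k * d′
closed-form-step {a} {a′} {a₀} {m} {k} {d′} {t} succ closed = +-cancelʳ-≡ (k * t) _ _ (begin
  a′ + suc k * m + k * t      ≡⟨ solve (a′ ∷ k ∷ m ∷ t ∷ []) ⟩
  a′ + (m + k * t) + k * m    ≡⟨ cong (_+ k * m) succ ⟩
  a + d′ + k * m              ≡⟨ solve (a ∷ d′ ∷ k ∷ m ∷ []) ⟩
  a + k * m + d′              ≡⟨ cong (_+ d′) closed ⟩
  a₀ + k * (d′ + t) + d′      ≡⟨ solve (a₀ ∷ k ∷ d′ ∷ t ∷ []) ⟩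
  a₀ + suc k * d′ + k * t     ∎)

step-difference : ∀ {a r a′ d′ t} → Step a r a′ d′ → r ∣ a * t + 1 → t < r → r ≡ d′ + t
step-difference {a} {r} {d′ = d′} {t} (1≤d′ , d′<r , q , eq , _) r∣at+1 t<r =
  sym (m∣n∧0<n<m+m⇒n≡m r∣d′+t (≤-trans 1≤d′ (m≤m+n d′ t)) (+-mono-< d′<r t<r))
  where
  expand : d′ * (a * t + 1) ≡ t * q * r + (d′ + t)
  expand = begin
    d′ * (a * t + 1)      ≡⟨ solve (d′ ∷ a ∷ t ∷ []) ⟩
    t * (a * d′) + d′     ≡⟨ cong (λ x → t * x + d′) eq ⟩
    t * (1 + q * r) + d′  ≡⟨ solve (t ∷ q ∷ r ∷ d′ ∷ []) ⟩
    t * q * r + (d′ + t)  ∎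
  r∣d′+t : r ∣ d′ + t
  r∣d′+t = ∣m+n∣m⇒∣n (subst (r ∣_) expand (∣n⇒∣m*n d′ r∣at+1)) (n∣m*n (t * q))

symmetric⇔ : ∀ {a : ℕ → ℕ} {β m r △} → 0 < β →
             (∀ i j → i + j ≡ β → a i + i * m ≡ a 0 + i * (r + j * △)) →
             Symmetric a β ⇔ m ≡ r
symmetric⇔ {a} {β} {m} {r} {△} 0<β closed = mk⇔ to from
  where
  to : Symmetric a β → m ≡ r
  to symmetric = *-cancelˡ-≡ m r β (+-cancelˡ-≡ (a 0) _ _ (begin
    a 0 + β * m            ≡⟨ cong (_+ β * m) (symmetric 0 z≤n) ⟩
    a β + β * m            ≡⟨ closed β 0 (+-identityʳ β) ⟩
    a 0 + β * (r + 0 * △)  ≡⟨ cong (λ x → a 0 + β * x) (+-identityʳ r) ⟩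
    a 0 + β * r            ∎))
    where instance _ = >-nonZero 0<β
  from : m ≡ r → Symmetric a β
  from m≡r i i≤β = begin
    a i                ≡⟨ a≡ i j (m+[n∸m]≡n i≤β) ⟩
    a 0 + △ * (i * j)  ≡⟨ cong (λ x → a 0 + △ * x) (*-comm i j) ⟩
    a 0 + △ * (j * i)  ≡⟨ a≡ j i (trans (+-comm j i) (m+[n∸m]≡n i≤β)) ⟨
    a j                ∎
    where
    j = β ∸ i
    a≡ : ∀ i j → i + j ≡ β → a i ≡ a 0 + △ * (i * j)
    a≡ i j i+j≡β = +-cancelʳ-≡ (i * r) _ _ (begin
      a i + i * r                  ≡⟨ cong (λ x → a i + i * x) m≡r ⟨
      a i + i * m                  ≡⟨ closed i j i+j≡β ⟩
      a 0 + i * (r + j * △)        ≡⟨ cong (a 0 +_) (solve (i ∷ r ∷ j ∷ △ ∷ [])) ⟩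
      a 0 + (△ * (i * j) + i * r)  ≡⟨ +-assoc (a 0) _ _ ⟨
      a 0 + △ * (i * j) + i * r    ∎)

inverse≡residue⇔∣square∸1 : ∀ {a₀ β m r △ D} → a₀ * △ + 1 ≡ m * D → D ≡ r + β * △ →
                             0 < m → m ≤ △ → 0 < r → r ≤ △ →
                             m ≡ r ⇔ △ ∣ D * D ∸ 1
inverse≡residue⇔∣square∸1 {a₀} {β} {m} {r} {△} {D} a₀△+1≡mD D≡r+β△ 0<m m≤△ 0<r r≤△ =
  mk⇔ to from
  where
  to : m ≡ r → △ ∣ D * D ∸ 1
  to m≡r = divides (a₀ + β * D) (cong (_∸ 1) (begin
    D * D                    ≡⟨ cong (_* D) D≡r+β△ ⟩
    (r + β * △) * D          ≡⟨ cong (λ x → (x + β * △) * D) m≡r ⟨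
    (m + β * △) * D          ≡⟨ solve (m ∷ β ∷ △ ∷ D ∷ []) ⟩
    m * D + β * △ * D        ≡⟨ cong (_+ β * △ * D) a₀△+1≡mD ⟨
    a₀ * △ + 1 + β * △ * D   ≡⟨ solve (a₀ ∷ △ ∷ β ∷ D ∷ []) ⟩
    1 + (a₀ + β * D) * △     ∎))
  from : △ ∣ D * D ∸ 1 → m ≡ r
  from (divides t D*D∸1≡t△) =
    residue-unique (m * t) (β + a₀ * D) 0<m m≤△ 0<r r≤△ (begin
      m + m * t * △              ≡⟨ solve (m ∷ t ∷ △ ∷ []) ⟩
      m * (t * △ + 1)            ≡⟨ cong (λ x → m * (x + 1)) D*D∸1≡t△ ⟨
      m * (D * D ∸ 1 + 1)        ≡⟨ cong (m *_) (m∸n+n≡m (*-mono-≤ 0<D 0<D)) ⟩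
      m * (D * D)                ≡⟨ *-assoc m D D ⟨
      m * D * D                  ≡⟨ cong (_* D) a₀△+1≡mD ⟨
      (a₀ * △ + 1) * D           ≡⟨ solve (a₀ ∷ △ ∷ D ∷ []) ⟩
      D + a₀ * D * △             ≡⟨ cong (_+ a₀ * D * △) D≡r+β△ ⟩
      r + β * △ + a₀ * D * △     ≡⟨ solve (r ∷ β ∷ △ ∷ a₀ ∷ D ∷ []) ⟩
      r + (β + a₀ * D) * △       ∎)
    where
    0<D : 0 < D
    0<D = subst (0 <_) (sym D≡r+β△) (≤-trans 0<r (m≤m+n r (β * △)))

module Grouping {a d : ℕ → ℕ} {β △ : ℕ} (grouping : FirstGrouping a d β △) where

  step : ∀ k → k < β → Step (a k) (d k) (a (suc k)) (d (suc k))
  step = proj₁ grouping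

  0<β : 0 < β
  0<β = proj₁ (proj₂ grouping)

  difference : ∀ k → k < β → d k ≡ d (suc k) + △
  difference = proj₁ (proj₂ (proj₂ grouping))

  maximal : (d β ≡ 1) ⊎ (Step (a β) (d β) (a (suc β)) (d (suc β)) × (d β ≢ d (suc β) + △))
  maximal = proj₂ (proj₂ (proj₂ grouping))

  step-with-difference : ∀ k → k < β → Step (a k) (d (suc k) + △) (a (suc k)) (d (suc k))
  step-with-difference k k<β =
    subst (λ x → Step (a k) x (a (suc k)) (d (suc k))) (difference k k<β) (step k k<β)

  0<△ : 0 < △
  0<△ = +-cancelˡ-< (d 1) 0 △
    (subst (_< d 1 + △) (sym (+-identityʳ (d 1))) (proj₁ (proj₂ (step-with-difference 0 0<β))))

  r : ℕ
  r = d β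

  d≡r+j△ : ∀ i j → i + j ≡ β → d i ≡ r + j * △
  d≡r+j△ i zero    i+0≡β   = trans (cong d (trans (sym (+-identityʳ i)) i+0≡β)) (sym (+-identityʳ r))
  d≡r+j△ i (suc j) i+1+j≡β = begin
    d i              ≡⟨ difference i (subst (i <_) i+1+j≡β (m<m+n i z<s)) ⟩
    d (suc i) + △    ≡⟨ cong (_+ △) (d≡r+j△ (suc i) j (trans (sym (+-suc i j)) i+1+j≡β)) ⟩
    r + j * △ + △    ≡⟨ +-assoc r (j * △) △ ⟩
    r + (j * △ + △)  ≡⟨ cong (r +_) (+-comm (j * △) △) ⟩
    r + suc j * △    ∎

  first-multiplier : ∃ λ M → a 0 * △ + 1 ≡ M * (d 1 + △)
  first-multiplier = step-multiplier {a 0} (step-with-difference 0 0<β)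

  m : ℕ
  m = proj₁ first-multiplier

  a₀△+1≡m*d₀ : a 0 * △ + 1 ≡ m * d 0
  a₀△+1≡m*d₀ = trans (proj₂ first-multiplier) (cong (m *_) (sym (difference 0 0<β)))

  multiplier         : ∀ k → k ≤ β → a k * △ + 1 ≡ (m + k * △) * d k
  multiplier-at-step : ∀ k → k < β → a k * △ + 1 ≡ (m + k * △) * (d (suc k) + △)
  successor          : ∀ k → k < β → a (suc k) + (m + k * △) ≡ a k + d (suc k)

  multiplier zero    _   = trans a₀△+1≡m*d₀ (cong (_* d 0) (sym (+-identityʳ m)))
  multiplier (suc k) k<β =
    trans (next-multiplier {a k} {a (suc k)} (multiplier-at-step k k<β) (successor k k<β))
          (cong (_* d (suc k)) (trans (+-assoc m (k * △) △) (cong (m +_) (+-comm (k * △) △))))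

  multiplier-at-step k k<β =
    trans (multiplier k (<⇒≤ k<β)) (cong ((m + k * △) *_) (difference k k<β))

  successor k k<β = step-successor (step-with-difference k k<β) (multiplier-at-step k k<β)

  closed-form : ∀ k → k ≤ β → a k + k * m ≡ a 0 + k * d k
  closed-form zero    _   = refl
  closed-form (suc k) k<β =
    closed-form-step {a k} {a (suc k)} {a 0} {m} {k} (successor k k<β)
      (trans (closed-form k (<⇒≤ k<β)) (cong (λ x → a 0 + k * x) (difference k k<β)))

  leading-term : ∀ i j → i + j ≡ β → a i + i * m ≡ a 0 + i * (r + j * △)
  leading-term i j i+j≡β = trans (closed-form i (subst (i ≤_) i+j≡β (m≤m+n i j)))
                                 (cong (λ x → a 0 + i * x) (d≡r+j△ i j i+j≡β))

  0<m : 0 < m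
  0<m = n≢0⇒n>0 (λ m≡0 → 1+n≢0 (trans (+-comm 1 (a 0 * △)) (trans a₀△+1≡m*d₀ (cong (_* d 0) m≡0))))

  m≤△ : a 0 < d 0 → m ≤ △
  m≤△ a₀<d₀ = *-cancelʳ-≤ m △ (d 0) (subst₂ _≤_ a₀△+1≡m*d₀ (*-comm (d 0) △) a₀△+1≤d₀△)
    where
    instance _ = >-nonZero (m<n⇒0<n a₀<d₀)
    a₀△+1≤d₀△ : a 0 * △ + 1 ≤ d 0 * △
    a₀△+1≤d₀△ = ≤-trans (+-monoʳ-≤ (a 0 * △) 0<△)
                        (subst (_≤ d 0 * △) (+-comm △ (a 0 * △)) (*-monoˡ-≤ △ a₀<d₀))

  0<r : 0 < r
  0<r with maximal
  ... | inj₁ r≡1                    = ≤-reflexive (sym r≡1)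
  ... | inj₂ ((0<d′ , d′<r , _) , _) = ≤-trans 0<d′ (<⇒≤ d′<r)

  r≤△ : r ≤ △
  r≤△ with maximal
  ... | inj₁ r≡1             = subst (_≤ △) (sym r≡1) 0<△
  ... | inj₂ (next , r≢d′+△) = ≮⇒≥ λ △<r →
    r≢d′+△ (step-difference {a β} next (divides (m + β * △) (multiplier β ≤-refl)) △<r)

-- Coprimality and 1 ≤ a 0 are not needed: both follow from the first step, a 0 * d 1 ≡ 1 (mod d 0).
theorem1 : (a d : ℕ → ℕ) (β △ : ℕ) →
    Coprime (a 0) (d 0) → 1 ≤ a 0 → a 0 < d 0 →
    FirstGrouping a d β △ →
    (Symmetric a β ⇔ △ ∣ (d 0 * d 0 ∸ 1))
theorem1 a d β △ _ _ a₀<d₀ grouping =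
  ⇔-trans (symmetric⇔ 0<β leading-term)
          (inverse≡residue⇔∣square∸1 {a 0} {β} a₀△+1≡m*d₀ (d≡r+j△ 0 β refl)
                                      0<m (m≤△ a₀<d₀) 0<r r≤△)
  where open Grouping {a} {d} grouping
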